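{- Let $N>1$. For every $x$ with $1\le x\le N-1$, the number of recursive trees on $N$ vertices whose smallest rooted path ends at the vertex labeled $x$ is $(N-2)!$.
   Context: A recursive tree on $N$ vertices is a tree with vertices labeled $0,1,\dots,N-1$, rooted at $0$, such that labels strictly increase along every path from the root. Its smallest rooted path is the path starting at the root that at each vertex proceeds to the child with the smallest label, until it reaches a vertex with no children. -}

module Defs where

open import Data.Nat using (ℕ; zero; suc; _≡ᵇ_)
open import Data.Fin using (Fin; toℕ)
open import Data.Maybe using (Maybe; just; nothing)
open import Data.Bool using (if_then_else_)

-- A recursive tree on N vertices (labels 0..N-1, rooted at 0, labels
-- increasing along root paths) is the same as a choice, for every
-- vertex j = 1..N-1, of a parent label p(j) < j.  We build it vertex
-- by vertex: 'single' is the one-vertex tree {0}; 'grow t p' adds the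
-- new vertex labelled N (t has N vertices) as a child of p < N.
data RecTree : ℕ → Set where
  single : RecTree 1
  grow   : ∀ {N} → RecTree N → Fin N → RecTree (suc N)

minChild : ∀ {N} → RecTree N → ℕ → Maybe ℕ
minChild single v = nothing
minChild (grow {N} t p) v with minChild t v
... | just c  = just c
... | nothing = if toℕ p ≡ᵇ v then just N else nothing

-- follow smallest children starting at v, with fuel (labels strictly
-- increase, so fuel N is enough for a tree on N vertices).
walk : ∀ {N} → ℕ → RecTree N → ℕ → ℕ
walk zero t v = v
walk (suc f) t v with minChild t v
... | nothing = v
... | just c  = walk f t c

pathEnd : ∀ {N} → RecTree N → ℕ
pathEnd {N} t = walk N t 0

-- Attaching the new vertex N to the current
-- endpoint of the smallest rooted path extends that path to N; attaching it
-- anywhere else leaves the path, hence its endpoint, unchanged.  So a tree on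
-- N+1 vertices ending at N is just a tree on N vertices, while a tree ending
-- at an older vertex x is a tree on N vertices ending at x together with one
-- of the N-1 parents other than the endpoint.  Starting from the (x-1)! trees
-- on x+1 vertices ending at x and multiplying by x, x+1, ..., N-2 gives (N-2)!.
module Submission where

open import Defs
open import Data.Bool using (true; false)
open import Data.Fin using (Fin; toℕ; fromℕ<; punchIn; punchOut)
import Data.Fin.Properties as Fin
open import Data.Maybe using (just; nothing)
open import Data.Nat using (ℕ; zero; suc; _+_; _<_; _≤_; _∸_; _!; _≡ᵇ_; z≤n; s≤s)
open import Data.Nat.Properties
  using (_≟_; ≤-refl; ≤-trans; n≤1+n; m<n⇒m<1+n; m≤m+n; <⇒≢; <⇒≱; +-suc; +-monoʳ-≤;
         ≡-irrelevant; m≤n⇒m<n∨m≡n; module ≤-Reasoning)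
open import Data.Product using (Σ; _×_; _,_; proj₁; proj₂; map₂; uncurry)
open import Data.Product.Algebra using (×-comm)
open import Data.Product.Function.NonDependent.Propositional using (_×-↔_)
open import Data.Sum using (inj₁; inj₂)
open import Function using (_∘_)
open import Function.Bundles using (_↔_; mk↔ₛ′)
open import Function.Properties.Inverse using (↔-refl; ↔-sym; ↔-trans)
open import Relation.Nullary using (yes; no; proof; ofʸ; contradiction)
open import Relation.Nullary.Decidable using (dec-true; dec-false)
open import Relation.Binary.PropositionalEquality
  using (_≡_; _≢_; refl; sym; trans; cong; cong₂)

-- `does (m ≟ n)` computes to `m ≡ᵇ n`, the test inside minChild; this is what
-- lets dec-true/dec-false and `proof (m ≟ n)` rewrite and split on that test.
minChild-outside : ∀ {N} (t : RecTree N) {v} → N ≤ v → minChild t v ≡ nothing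
minChild-outside single _ = refl
minChild-outside (grow {N} t p) {v} N<v
  rewrite minChild-outside t (≤-trans (n≤1+n N) N<v)
        | dec-false (toℕ p ≟ v) (<⇒≢ (≤-trans (Fin.toℕ<n p) (≤-trans (n≤1+n N) N<v)))
  = refl

minChild-increasing : ∀ {N} (t : RecTree N) {v c} → minChild t v ≡ just c → v < c × c < N
minChild-increasing (grow t p) {v} eq with minChild t v in e
... | just c with refl ← eq = map₂ m<n⇒m<1+n (minChild-increasing t e)
... | nothing with toℕ p ≡ᵇ v | proof (toℕ p ≟ v)
...   | true  | ofʸ refl with refl ← eq = Fin.toℕ<n p , ≤-refl
...   | false | _ with () ← eq

newest-is-leaf : ∀ {N} (t : RecTree N) (p : Fin N) → minChild (grow t p) N ≡ nothing
newest-is-leaf {N} t p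
  rewrite minChild-outside t (≤-refl {N}) | dec-false (toℕ p ≟ N) (<⇒≢ (Fin.toℕ<n p))
  = refl

walk-from-leaf : ∀ {N} (t : RecTree N) f {v} → minChild t v ≡ nothing → walk f t v ≡ v
walk-from-leaf t zero    _ = refl
walk-from-leaf t (suc f) {v} leaf with minChild t v
... | nothing = refl

walk-< : ∀ {N} (t : RecTree N) f {v} → v < N → walk f t v < N
walk-< t zero    v<N = v<N
walk-< t (suc f) {v} v<N with minChild t v in e
... | nothing = v<N
... | just c  = walk-< t f (proj₂ (minChild-increasing t e))

-- Each step increases the label, so f + v is a bound the walk cannot outrun.
walk-reaches-leaf : ∀ {N} (t : RecTree N) f {v} → N ≤ f + v → minChild t (walk f t v) ≡ nothing
walk-reaches-leaf t zero    N≤v = minChild-outside t N≤v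
walk-reaches-leaf t (suc f) {v} N≤1+f+v with minChild t v in e
... | nothing = e
... | just c  = walk-reaches-leaf t f (≤-trans N≤1+f+v (begin
      suc f + v  ≡⟨ sym (+-suc f v) ⟩
      f + suc v  ≤⟨ +-monoʳ-≤ f (proj₁ (minChild-increasing t e)) ⟩
      f + c      ∎))
  where open ≤-Reasoning

walk-grow : ∀ {N} (t : RecTree N) (p : Fin N) f {v} → minChild t (walk f t v) ≡ nothing →
            walk (suc f) (grow t p) v ≡ walk 1 (grow t p) (walk f t v)
walk-grow t p zero    _ = refl
walk-grow t p (suc f) {v} leaf with minChild t v in e
... | just c  = walk-grow t p f leaf
... | nothing rewrite e with toℕ p ≡ᵇ v
...   | true  = walk-from-leaf (grow t p) (suc f) (newest-is-leaf t p)
...   | false = refl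

pathEnd-< : ∀ {n} (t : RecTree (suc n)) → pathEnd t < suc n
pathEnd-< t = walk-< t _ (s≤s z≤n)

pathEndFin : ∀ {n} → RecTree (suc n) → Fin (suc n)
pathEndFin t = fromℕ< (pathEnd-< t)

pathEnd-is-leaf : ∀ {N} (t : RecTree N) → minChild t (pathEnd t) ≡ nothing
pathEnd-is-leaf {N} t = walk-reaches-leaf t N (m≤m+n N 0)

pathEnd-grow : ∀ {N} (t : RecTree N) (p : Fin N) →
               pathEnd (grow t p) ≡ walk 1 (grow t p) (pathEnd t)
pathEnd-grow {N} t p = walk-grow t p N (pathEnd-is-leaf t)

walk-grow-from-leaf-at : ∀ {N} (t : RecTree N) {p : Fin N} {l} → minChild t l ≡ nothing →
                         toℕ p ≡ l → walk 1 (grow t p) l ≡ N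
walk-grow-from-leaf-at t {p} leaf refl rewrite leaf | dec-true (toℕ p ≟ toℕ p) refl = refl

walk-grow-from-leaf-elsewhere : ∀ {N} (t : RecTree N) {p : Fin N} {l} →
                                minChild t l ≡ nothing → toℕ p ≢ l →
                                walk 1 (grow t p) l ≡ l
walk-grow-from-leaf-elsewhere t {p} {l} leaf p≢l rewrite leaf | dec-false (toℕ p ≟ l) p≢l = refl

pathEnd-grow-at-end : ∀ {n} (t : RecTree (suc n)) → pathEnd (grow t (pathEndFin t)) ≡ suc n
pathEnd-grow-at-end t = trans (pathEnd-grow t (pathEndFin t))
  (walk-grow-from-leaf-at t (pathEnd-is-leaf t) (Fin.toℕ-fromℕ< (pathEnd-< t)))

pathEnd-grow-elsewhere : ∀ {n} (t : RecTree (suc n)) {p} → p ≢ pathEndFin t →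
                         pathEnd (grow t p) ≡ pathEnd t
pathEnd-grow-elsewhere t {p} p≢end = trans (pathEnd-grow t p)
  (walk-grow-from-leaf-elsewhere t (pathEnd-is-leaf t)
    (p≢end ∘ Fin.toℕ-injective ∘ λ q → trans q (sym (Fin.toℕ-fromℕ< (pathEnd-< t)))))

RecTreeEndingAt : ℕ → ℕ → Set
RecTreeEndingAt N x = Σ (RecTree N) (λ t → pathEnd t ≡ x)

ending-≡ : ∀ {N x} {s t : RecTree N} {e e′} → s ≡ t →
           _≡_ {A = RecTreeEndingAt N x} (s , e) (t , e′)
ending-≡ refl = cong (_ ,_) (≡-irrelevant _ _)

grow↔ : ∀ n → RecTree (suc (suc n)) ↔ (RecTree (suc n) × Fin (suc n))
grow↔ n = mk↔ₛ′ (λ { (grow t p) → t , p }) (uncurry grow)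
                (λ _ → refl) (λ { (grow t p) → refl })

×Fin↔Fin! : ∀ {a} {A : Set a} m → A ↔ Fin (m !) → (A × Fin (suc m)) ↔ Fin (suc m !)
×Fin↔Fin! m A↔ = ↔-trans (A↔ ×-↔ ↔-refl)
                 (↔-trans (×-comm _ _) (↔-sym (Fin.*↔× {suc m} {m !})))

RecTree↔Fin! : ∀ n → RecTree (suc n) ↔ Fin (n !)
RecTree↔Fin! zero    = mk↔ₛ′ (λ _ → Fin.zero) (λ _ → single)
  (λ { Fin.zero → refl ; (Fin.suc ()) }) (λ { single → refl })
RecTree↔Fin! (suc n) = ↔-trans (grow↔ n) (×Fin↔Fin! n (RecTree↔Fin! n))

grow-parent-is-end : ∀ {n} (t : RecTree (suc n)) {p} → pathEnd (grow t p) ≡ suc n →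
                     p ≡ pathEndFin t
grow-parent-is-end t {p} e with p Fin.≟ pathEndFin t
... | yes p≡end = p≡end
... | no  p≢end =
  contradiction (trans (sym (pathEnd-grow-elsewhere t p≢end)) e) (<⇒≢ (pathEnd-< t))

grow-parent-not-end : ∀ {n x} (t : RecTree (suc n)) {p} → pathEnd (grow t p) ≡ x → x ≤ n →
                      p ≢ pathEndFin t
grow-parent-not-end t e x≤n refl = <⇒≢ (s≤s x≤n) (trans (sym e) (pathEnd-grow-at-end t))

ending-at-newest↔ : ∀ n → RecTreeEndingAt (suc (suc n)) (suc n) ↔ RecTree (suc n)
ending-at-newest↔ n = mk↔ₛ′
  (λ { (grow t _ , _) → t })
  (λ t → grow t (pathEndFin t) , pathEnd-grow-at-end t)
  (λ _ → refl)
  (λ { (grow t p , e) → ending-≡ (cong (grow t) (sym (grow-parent-is-end t e))) })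

ending-at-older↔ : ∀ n {x} → x ≤ n →
                   RecTreeEndingAt (suc (suc n)) x ↔ (RecTreeEndingAt (suc n) x × Fin n)
ending-at-older↔ n {x} x≤n = mk↔ₛ′ to from to∘from from∘to
  where
  to : RecTreeEndingAt (suc (suc n)) x → RecTreeEndingAt (suc n) x × Fin n
  to (grow t p , e) = (t , trans (sym (pathEnd-grow-elsewhere t p≢end)) e)
                    , punchOut (p≢end ∘ sym)
    where p≢end = grow-parent-not-end t e x≤n

  from : RecTreeEndingAt (suc n) x × Fin n → RecTreeEndingAt (suc (suc n)) x
  from ((t , e) , j) = grow t (punchIn (pathEndFin t) j)
                     , trans (pathEnd-grow-elsewhere t (Fin.punchInᵢ≢i _ j)) e

  to∘from : ∀ s → to (from s) ≡ s
  to∘from ((t , e) , j) = cong₂ _,_ (ending-≡ refl)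
    (trans (Fin.punchOut-cong (pathEndFin t) refl) (Fin.punchOut-punchIn (pathEndFin t)))

  from∘to : ∀ s → from (to s) ≡ s
  from∘to (grow t p , e) = ending-≡ (cong (grow t) (Fin.punchIn-punchOut _))

ending-at↔Fin! : ∀ n {x} → 1 ≤ x → x ≤ suc n → RecTreeEndingAt (suc (suc n)) x ↔ Fin (n !)
ending-at↔Fin! n {x} 1≤x x≤1+n with m≤n⇒m<n∨m≡n x≤1+n
... | inj₂ refl = ↔-trans (ending-at-newest↔ n) (RecTree↔Fin! n)
ending-at↔Fin! zero    1≤x _ | inj₁ (s≤s x≤0) = contradiction x≤0 (<⇒≱ 1≤x)
ending-at↔Fin! (suc n) 1≤x _ | inj₁ (s≤s x≤1+n) =
  ↔-trans (ending-at-older↔ (suc n) x≤1+n) (×Fin↔Fin! n (ending-at↔Fin! n 1≤x x≤1+n))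

lemma7p9 : (N : ℕ) → 1 < N → (x : ℕ) → 1 ≤ x → x ≤ N ∸ 1 →
    Σ (RecTree N) (λ t → pathEnd t ≡ x) ↔ Fin ((N ∸ 2) !)
lemma7p9 (suc zero)    (s≤s ())
lemma7p9 (suc (suc n)) _ x = ending-at↔Fin! n
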